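{- Let $d\geq 2$ be an integer, let $\lambda=(\lambda_1,\ldots,\lambda_\ell)$ and $\mu=(\mu_1,\ldots,\mu_\ell)$ be two $d$-ary partitions with $\ell$ parts each, and let $1\leq j\leq \ell-1$ be an integer. If $\mathcal E_j(\lambda)=\mathcal E_j(\mu)$ and $\lambda_{i_1}\cdots\lambda_{i_j}=\mu_{i_1}\cdots\mu_{i_j}$ for all $1\leq i_1<\cdots<i_j\leq \ell$, then $\lambda=\mu$.
   Context: A partition $\lambda=(\lambda_1,\ldots,\lambda_\ell)$ is a finite non-increasing sequence $\lambda_1\geq\cdots\geq\lambda_\ell\geq1$ of positive integers; $\ell$ is its length. For an integer $d\geq2$, $\lambda$ is $d$-ary if every $\lambda_i$ is a power of $d$ (including $d^0=1$). For $1\leq j\leq \ell$, the elementary symmetric partition $\mathcal E_j(\lambda)$ is the partition whose parts are the products $\lambda_{i_1}\cdots\lambda_{i_j}$ over all $1\leq i_1<\cdots<i_j\leq\ell$ (counted with multiplicity, arranged in non-increasing order). -}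

module Defs where

open import Data.Nat using (ℕ; zero; suc; _≥_; _^_; _≤_)
open import Data.Nat.Properties using (≤-decTotalOrder)
open import Data.List using (List; []; _∷_; _++_; map)
open import Data.Nat.ListAction using (product)
open import Data.Vec using (Vec; toList)
open import Data.Product using (∃-syntax; _×_)
open import Data.List.Relation.Unary.Linked using (Linked)
open import Data.List.Relation.Unary.All using (All)
open import Relation.Binary.PropositionalEquality using (_≡_)
import Data.List.Sort
import Relation.Binary.Properties.DecTotalOrder as DTO

IsPartition : {ℓ : ℕ} → Vec ℕ ℓ → Set
IsPartition v = Linked _≥_ (toList v) × All (1 ≤_) (toList v)

IsDAry : (d : ℕ) {ℓ : ℕ} → Vec ℕ ℓ → Set
IsDAry d v = All (λ x → ∃[ k ] x ≡ d ^ k) (toList v)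

-- all sublists of length j (order preserved), i.e. all choices i₁ < ⋯ < i_j
choose : {A : Set} → ℕ → List A → List (List A)
choose zero    _        = [] ∷ []
choose (suc j) []       = []
choose (suc j) (x ∷ xs) = map (x ∷_) (choose j xs) ++ choose (suc j) xs

open Data.List.Sort (DTO.≥-decTotalOrder ≤-decTotalOrder) using () renaming (sort to sortDesc)

E : {ℓ : ℕ} → ℕ → Vec ℕ ℓ → List ℕ
E j v = sortDesc (map product (choose j (toList v)))

module Submission where

-- Only the equality of the products over each index set i₁ < ⋯ < i_j and the
-- positivity of the parts are needed. Splitting the j-subsets according to
-- whether they contain the first index w yields weighted identities between the
-- (j−1)- and j-subsets of the remaining indices, and an induction on such
-- weighted identities gives λ_w μ_q = μ_w λ_q for every q: all ratios λ_q / μ_q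
-- equal a common r. Any single j-subset then has r^j = 1, so r = 1.

open import Defs
open import Data.Nat using (ℕ; zero; suc; _+_; _*_; _^_; _≤_; _<_; s≤s; z≤n; NonZero; >-nonZero)
open import Data.Nat.Properties
open import Data.Nat.ListAction using (product)
open import Data.Nat.ListAction.Properties using (product≢0)
open import Data.Nat.Tactic.RingSolver using (solve-∀)
open import Data.Fin using (Fin)
open import Data.List using (List; []; _∷_; map; length; allFin)
open import Data.List.Properties using (length-tabulate)
open import Data.List.Membership.Propositional using (_∈_)
open import Data.List.Membership.Propositional.Properties using (∈-map⁺; ∈-map⁻; ∈-++⁺ˡ; ∈-++⁺ʳ; ∈-++⁻; ∈-allFin)
open import Data.List.Relation.Binary.Subset.Propositional using (_⊆_)
open import Data.List.Relation.Unary.Any using (here; there)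
import Data.List.Relation.Unary.All as All
open import Data.List.Relation.Unary.All.Properties using (map⁺)
open import Data.Vec using (Vec; lookup; toList)
open import Data.Vec.Properties using (tabulate∘lookup; tabulate-cong)
open import Data.Vec.Membership.Propositional.Properties using (∈-lookup; ∈-toList⁺)
open import Data.Product using (∃; _,_)
open import Data.Sum using (inj₁; inj₂)
open import Function using (_∘_)
open import Relation.Nullary using (contradiction)
open import Relation.Binary using (tri<; tri≈; tri>)
open import Relation.Binary.PropositionalEquality using (_≡_; refl; sym; trans; cong; cong₂; module ≡-Reasoning)
open import Algebra.Properties.CommutativeSemigroup *-commutativeSemigroup using (interchange)

module _ {X : Set} where

  ∈-choose-∷ : ∀ {k w ws} {T : List X} → T ∈ choose k ws → T ∈ choose k (w ∷ ws)
  ∈-choose-∷ {zero}  T∈ = T∈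
  ∈-choose-∷ {suc k} {w} {ws} T∈ = ∈-++⁺ʳ (map (w ∷_) (choose k ws)) T∈

  ∷-∈-choose : ∀ {k w ws} {T : List X} → T ∈ choose k ws → (w ∷ T) ∈ choose (suc k) (w ∷ ws)
  ∷-∈-choose T∈ = ∈-++⁺ˡ (∈-map⁺ _ T∈)

  choose-inhabited : ∀ k (ws : List X) → k ≤ length ws → ∃ λ T → T ∈ choose k ws
  choose-inhabited zero    ws       _       = [] , here refl
  choose-inhabited (suc k) (w ∷ ws) (s≤s k≤) with choose-inhabited k ws k≤
  ... | T , T∈ = w ∷ T , ∷-∈-choose {k} T∈

  length-∈-choose : ∀ k (ws : List X) {T} → T ∈ choose k ws → length T ≡ k
  length-∈-choose zero    ws       (here refl) = refl
  length-∈-choose (suc k) (w ∷ ws) T∈ with ∈-++⁻ (map (w ∷_) (choose k ws)) T∈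
  ... | inj₂ T∈′ = length-∈-choose (suc k) ws T∈′
  ... | inj₁ wT∈ with ∈-map⁻ (w ∷_) wT∈
  ...   | T′ , T′∈ , refl = cong suc (length-∈-choose k ws T′∈)

  ∈-choose⇒⊆ : ∀ k (ws : List X) {T} → T ∈ choose k ws → T ⊆ ws
  ∈-choose⇒⊆ zero    ws       (here refl) ()
  ∈-choose⇒⊆ (suc k) (w ∷ ws) T∈ with ∈-++⁻ (map (w ∷_) (choose k ws)) T∈
  ... | inj₂ T∈′ = there ∘ ∈-choose⇒⊆ (suc k) ws T∈′
  ... | inj₁ wT∈ with ∈-map⁻ (w ∷_) wT∈
  ...   | T′ , T′∈ , refl = λ { (here refl) → here refl
                            ; (there q∈) → there (∈-choose⇒⊆ k ws T′∈ q∈) }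

^-cancelʳ-≡ : ∀ n .{{_ : NonZero n}} {a b} → a ^ n ≡ b ^ n → a ≡ b
^-cancelʳ-≡ n {a} {b} aⁿ≡bⁿ with <-cmp a b
... | tri< a<b _ _ = contradiction aⁿ≡bⁿ (<⇒≢ (^-monoˡ-< n a<b))
... | tri≈ _ a≡b _ = a≡b
... | tri> _ _ a>b = contradiction aⁿ≡bⁿ (>⇒≢ (^-monoˡ-< n a>b))

product-map-nonZero : ∀ {X : Set} {f : X → ℕ} → (∀ q → NonZero (f q)) → ∀ S → NonZero (product (map f S))
product-map-nonZero f≢0 S = product≢0 (map⁺ (All.universal f≢0 S))

module _ {X : Set} (x y : X → ℕ) where

  ∏x ∏y : List X → ℕ
  ∏x S = product (map x S)
  ∏y S = product (map y S)

  -- A record rather than a function type, so that its indices can be inferred.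
  record Balanced (k : ℕ) (ws : List X) (a b : ℕ) : Set where
    constructor balanced
    field balance : ∀ {S} → S ∈ choose k ws → a * ∏x S ≡ b * ∏y S

  open Balanced

  balanced-without-head : ∀ {k w ws a b} → Balanced k (w ∷ ws) a b → Balanced k ws a b
  balanced-without-head {k} bal = balanced λ S∈ → balance bal (∈-choose-∷ {k = k} S∈)

  balanced-with-head : ∀ {k w ws a b} → Balanced (suc k) (w ∷ ws) a b → Balanced k ws (a * x w) (b * y w)
  balanced-with-head {k} {w} {ws} {a} {b} bal = balanced λ {S} S∈ → begin
    a * x w * ∏x S   ≡⟨ *-assoc a _ _ ⟩
    a * ∏x (w ∷ S)   ≡⟨ balance bal (∷-∈-choose {k = k} S∈) ⟩
    b * ∏y (w ∷ S)   ≡⟨ *-assoc b _ _ ⟨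
    b * y w * ∏y S   ∎
    where open ≡-Reasoning

  ^-length-∏ : ∀ {a b} S → (∀ {q} → q ∈ S → a * y q ≡ b * x q) →
               a ^ length S * ∏y S ≡ b ^ length S * ∏x S
  ^-length-∏ []      _ = refl
  ^-length-∏ {a} {b} (q ∷ S) h = begin
    a * a ^ length S * (y q * ∏y S)      ≡⟨ interchange a _ _ _ ⟩
    a * y q * (a ^ length S * ∏y S)      ≡⟨ cong₂ _*_ (h (here refl)) (^-length-∏ S (h ∘ there)) ⟩
    b * x q * (b ^ length S * ∏x S)      ≡⟨ interchange b _ _ _ ⟩
    b * b ^ length S * (x q * ∏x S)      ∎
    where open ≡-Reasoning

  module _ (x≢0 : ∀ q → NonZero (x q)) (y≢0 : ∀ q → NonZero (y q)) where

    -- If q is the head w, compare a k-subset T of the tail with w ∷ T;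
    -- otherwise move the head into the weights and recurse.
    balanced-cross : ∀ k ws {a b c d q} → q ∈ ws → suc k ≤ length ws →
                     Balanced k ws a b → Balanced (suc k) ws c d → a * d * y q ≡ b * c * x q
    balanced-cross k (w ∷ ws) {a} {b} {c} {d} (here refl) (s≤s k≤) bal bal′
      with T , T∈ ← choose-inhabited k ws k≤ =
      *-cancelʳ-≡ _ _ (∏x T * ∏y T) {{∏x∏y≢0}} (begin
        a * d * y w * (∏x T * ∏y T)       ≡⟨ regroup a d (y w) (∏x T) (∏y T) ⟩
        (a * ∏x T) * (d * (y w * ∏y T))   ≡⟨ cong₂ _*_ (balance (balanced-without-head bal) T∈)
                                                        (sym (balance bal′ (∷-∈-choose {k = k} T∈))) ⟩
        (b * ∏y T) * (c * (x w * ∏x T))   ≡⟨ regroup′ b c (x w) (∏x T) (∏y T) ⟩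
        b * c * x w * (∏x T * ∏y T)       ∎)
      where
      open ≡-Reasoning
      ∏x∏y≢0 : NonZero (∏x T * ∏y T)
      ∏x∏y≢0 = m*n≢0 _ _ {{product-map-nonZero x≢0 T}} {{product-map-nonZero y≢0 T}}
      regroup : ∀ a d e P Q → a * d * e * (P * Q) ≡ (a * P) * (d * (e * Q))
      regroup = solve-∀
      regroup′ : ∀ b c e P Q → (b * Q) * (c * (e * P)) ≡ b * c * e * (P * Q)
      regroup′ = solve-∀
    balanced-cross zero (w ∷ v ∷ ws) (there q∈) _ bal bal′ =
      balanced-cross zero (v ∷ ws) q∈ (s≤s z≤n) (balanced-without-head bal) (balanced-without-head bal′)
    balanced-cross (suc k) (w ∷ ws) {a} {b} {c} {d} {q} (there q∈) (s≤s k<) bal bal′ =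
      *-cancelʳ-≡ _ _ (x w * y w) {{m*n≢0 _ _ {{x≢0 w}} {{y≢0 w}}}} (begin
        a * d * y q * (x w * y w)         ≡⟨ regroup a d (y q) (x w) (y w) ⟩
        a * x w * (d * y w) * y q         ≡⟨ balanced-cross k ws q∈ k< (balanced-with-head bal) (balanced-with-head bal′) ⟩
        b * y w * (c * x w) * x q         ≡⟨ regroup′ b c (x q) (x w) (y w) ⟩
        b * c * x q * (x w * y w)         ∎)
      where
      open ≡-Reasoning
      regroup : ∀ a d e P Q → a * d * e * (P * Q) ≡ a * P * (d * Q) * e
      regroup = solve-∀
      regroup′ : ∀ b c e P Q → b * Q * (c * P) * e ≡ b * c * e * (P * Q)
      regroup′ = solve-∀

    balanced-ratio : ∀ k w ws {q} → suc k ≤ length ws → Balanced (suc k) (w ∷ ws) 1 1 →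
                     q ∈ w ∷ ws → x w * y q ≡ y w * x q
    balanced-ratio k w ws k< bal (here refl) = *-comm (x w) (y w)
    balanced-ratio k w ws {q} k< bal (there q∈) = begin
      x w * y q           ≡⟨ drop-ones (x w) (y q) ⟨
      1 * x w * 1 * y q   ≡⟨ balanced-cross k ws q∈ k< (balanced-with-head bal) (balanced-without-head bal) ⟩
      1 * y w * 1 * x q   ≡⟨ drop-ones (y w) (x q) ⟩
      y w * x q           ∎
      where
      open ≡-Reasoning
      drop-ones : ∀ m n → 1 * m * 1 * n ≡ m * n
      drop-ones = solve-∀

    balanced⇒≡ : ∀ j ws → 1 ≤ j → j < length ws → Balanced j ws 1 1 → ∀ {q} → q ∈ ws → x q ≡ y q
    balanced⇒≡ (suc k) (w ∷ ws) _ (s≤s k<) bal {q} q∈ =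
      sym (*-cancelˡ-≡ (y q) (x q) (x w) {{x≢0 w}} (trans (ratio q∈) (cong (_* x q) (sym xw≡yw))))
      where
      ratio : ∀ {q} → q ∈ w ∷ ws → x w * y q ≡ y w * x q
      ratio = balanced-ratio k w ws k< bal
      xw≡yw : x w ≡ y w
      xw≡yw with S , S∈ ← choose-inhabited (suc k) (w ∷ ws) (m≤n⇒m≤1+n k<) =
        ^-cancelʳ-≡ (suc k) (*-cancelʳ-≡ _ _ (∏y S) {{product-map-nonZero y≢0 S}} (begin
          x w ^ suc k * ∏y S      ≡⟨ cong (λ n → x w ^ n * ∏y S) |S|≡ ⟨
          x w ^ length S * ∏y S   ≡⟨ ^-length-∏ S (ratio ∘ ∈-choose⇒⊆ (suc k) (w ∷ ws) S∈) ⟩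
          y w ^ length S * ∏x S   ≡⟨ cong₂ (λ n m → y w ^ n * m) |S|≡ ∏x≡∏y ⟩
          y w ^ suc k * ∏y S      ∎))
        where
        open ≡-Reasoning
        |S|≡ : length S ≡ suc k
        |S|≡ = length-∈-choose (suc k) (w ∷ ws) S∈
        ∏x≡∏y : ∏x S ≡ ∏y S
        ∏x≡∏y = trans (sym (*-identityˡ _)) (trans (balance bal S∈) (*-identityˡ _))

lookup-nonZero : ∀ {ℓ} (v : Vec ℕ ℓ) → All.All (1 ≤_) (toList v) → ∀ i → NonZero (lookup v i)
lookup-nonZero v pos i = >-nonZero (All.lookup pos (∈-toList⁺ (∈-lookup i v)))

lookup-ext : ∀ {ℓ} (u v : Vec ℕ ℓ) → (∀ i → lookup u i ≡ lookup v i) → u ≡ v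
lookup-ext u v eq = trans (sym (tabulate∘lookup u)) (trans (tabulate-cong eq) (tabulate∘lookup v))

theorem4p2 : (d : ℕ) → 2 ≤ d → (ℓ : ℕ) → (λ′ μ : Vec ℕ ℓ) →
    IsPartition λ′ → IsDAry d λ′ → IsPartition μ → IsDAry d μ →
    (j : ℕ) → 1 ≤ j → j + 1 ≤ ℓ →
    E j λ′ ≡ E j μ →
    ((is : List (Fin ℓ)) → is ∈ choose j (allFin ℓ) →
      product (map (lookup λ′) is) ≡ product (map (lookup μ) is)) →
    λ′ ≡ μ
theorem4p2 _ _ ℓ λ′ μ (_ , λ≥1) _ (_ , μ≥1) _ j j≥1 j+1≤ℓ _ same-products =
  lookup-ext λ′ μ λ i →
    balanced⇒≡ (lookup λ′) (lookup μ) (lookup-nonZero λ′ λ≥1) (lookup-nonZero μ μ≥1)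
               j (allFin ℓ) j≥1 j<ℓ bal (∈-allFin i)
  where
  j<ℓ : j < length (allFin ℓ)
  j<ℓ rewrite length-tabulate {A = Fin ℓ} (λ i → i) | +-comm 1 j = j+1≤ℓ
  bal : Balanced (lookup λ′) (lookup μ) j (allFin ℓ) 1 1
  bal = balanced λ {S} S∈ → cong (1 *_) (same-products S S∈)
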